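{- Let $\sigma$ be a silver number with silver polynomial $X^N-\sum_{j=1}^N b_jX^{N-j}$. Assume that $b_1=1$, or that $N$ is prime, or that $b_{s_1}=b_{s_2}=1$ for two relatively prime integers $s_1,s_2$ with $1<s_j<N$. Then the companion matrix \[ U_\sigma=\begin{pmatrix} b_1&b_2&\cdots&b_{N-1}&b_N\\ 1&0&\cdots&0&0\\ 0&1&\ddots&&\vdots\\ \vdots&&\ddots&0&0\\ 0&\cdots&0&1&0\end{pmatrix} \] is primitive. In particular, if $\sigma$ is a distinguished silver number (all $b_j=1$), then $U_\sigma$ is primitive.
   Context: A silver polynomial of degree $N\geq2$ is $X^N-\sum_{j=1}^Nb_jX^{N-j}$ with all $b_j\in\{0,1\}$, $b_N=1$ and $\sum_j b_j>1$; its silver number is its largest positive real root. A non-negative real square matrix is primitive if some positive power has all entries strictly positive. -}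

module Defs where

open import Data.Nat using (ℕ; zero; suc; _+_; _*_; _≤_; _<_; _≡ᵇ_)
open import Data.Bool using (Bool; true; false; if_then_else_)
open import Data.Fin using (Fin; toℕ)
open import Data.List using (map; allFin)
open import Data.Nat.ListAction using (sum)
open import Relation.Binary.PropositionalEquality using (_≡_)
open import Data.Product using (Σ; _×_)

-- Coefficient vector of a silver polynomial of degree N:
-- b : Fin N → Bool, where b k stands for b_{k+1} ∈ {0,1} (true = 1).

-- 1-indexed access: bAt b j = b_j for 1 ≤ j ≤ N, and false otherwise.
bAt : ∀ {N} → (Fin N → Bool) → ℕ → Bool
bAt {zero}  b j             = false
bAt {suc N} b zero          = false
bAt {suc N} b (suc zero)    = b Fin.zero
bAt {suc N} b (suc (suc j)) = bAt {N} (λ k → b (Fin.suc k)) (suc j)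

boolToℕ : Bool → ℕ
boolToℕ true  = 1
boolToℕ false = 0

countOnes : ∀ {N} → (Fin N → Bool) → ℕ
countOnes {N} b = sum (map (λ k → boolToℕ (b k)) (allFin N))

IsSilver : (N : ℕ) → (Fin N → Bool) → Set
IsSilver N b = (2 ≤ N) × (bAt b N ≡ true) × (1 < countOnes b)

Matrix : ℕ → Set
Matrix N = Fin N → Fin N → ℕ

companion : ∀ {N} → (Fin N → Bool) → Matrix N
companion {suc n} b Fin.zero    j = boolToℕ (b j)
companion {suc n} b (Fin.suc i) j = if toℕ j ≡ᵇ toℕ i then 1 else 0

mmul : ∀ {N} → Matrix N → Matrix N → Matrix N
mmul {N} A B i j = sum (map (λ k → A i k * B k j) (allFin N))

identity : ∀ {N} → Matrix N
identity i j = if toℕ i ≡ᵇ toℕ j then 1 else 0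

mpow : ∀ {N} → Matrix N → ℕ → Matrix N
mpow A zero    = identity
mpow A (suc m) = mmul (mpow A m) A

Primitive : ∀ {N} → Matrix N → Set
Primitive {N} A = Σ ℕ (λ m → (1 ≤ m) × ((i j : Fin N) → 0 < mpow A m i j))

{-# OPTIONS --safe #-}
-- U is the adjacency matrix of the digraph on 0, …, N-1 with edges i+1 → i and
-- 0 → k whenever b_{k+1} = 1, so U^m has a positive (i, j) entry whenever there is
-- a walk of length m from i to j.  Every vertex descends to 0 and, as b_N = 1,
-- vertex 0 reaches every vertex, both within N steps.  Each b_s = 1 closes a walk
-- of length s at 0.  Closed walks concatenate, so by Bézout two coprime such s give
-- closed walks at 0 of every length ≥ K, and then U^(K + 1 + 2N) > 0.  The coprime
-- pair is (1, N) if b_1 = 1, and (s, N) for some s < N with b_s = 1 (it exists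
-- because ∑ b_j > 1) if N is prime.
module Submission where

open import Defs
open import Data.Nat using (ℕ; zero; suc; _+_; _*_; _∸_; _≤_; _<_; _≡ᵇ_; z≤n; s≤s; z<s)
open import Data.Nat.Properties
open import Data.Nat.DivMod using (_/_; _%_; m≡m%n+[m/n]*n; m%n<n; m*n/n≡m; /-monoˡ-≤)
open import Data.Nat.ListAction using (sum)
open import Data.Nat.Primality using (Prime)
open import Data.Nat.Coprimality using (Coprime; coprime-Bézout; 1-coprimeTo; prime⇒coprime)
import Data.Nat.Coprimality as Coprimality
open import Data.Nat.GCD using (module Bézout)
open import Data.Nat.Solver using (module +-*-Solver)
open import Data.Fin using (Fin; zero; suc; toℕ; inject₁)
open import Data.Fin.Properties using (toℕ-injective; toℕ-inject₁; toℕ<n; toℕ≤pred[n])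
open import Data.Bool using (Bool; true; false; if_then_else_)
open import Data.Bool.Properties using (T-≡)
open import Data.List using (_∷_)
open import Data.List.Properties using (map-tabulate)
open import Data.List.Membership.Propositional using (_∈_)
open import Data.List.Membership.Propositional.Properties using (∈-map⁺; ∈-allFin)
open import Data.List.Relation.Unary.Any using (here; there)
open import Data.Product using (Σ; _×_; _,_; ∃-syntax)
open import Data.Sum using (_⊎_; inj₁; inj₂)
open import Function using (_∘_; id)
open import Function.Bundles using (Equivalence)
open import Relation.Unary using (Pred)
open import Relation.Binary.PropositionalEquality using (_≡_; refl; sym; trans; cong; cong₂; subst; module ≡-Reasoning)

Eventually : ∀ {p} → Pred ℕ p → Set p
Eventually P = ∃[ K ] (∀ {L} → K ≤ L → P L)

module AdditivelyClosed {p} (P : Pred ℕ p) (P-0 : P 0) (P-+ : ∀ {m n} → P m → P n → P (m + n)) where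

  P-* : ∀ k {n} → P n → P (k * n)
  P-* zero    _  = P-0
  P-* (suc k) Pn = P-+ Pn (P-* k Pn)

  consecutive⇒eventually : ∀ c → P c → P (suc c) → Eventually P
  consecutive⇒eventually zero    _  P1 = 0 , λ {L} _ → subst P (*-identityʳ L) (P-* L P1)
  consecutive⇒eventually c@(suc _) Pc Pc+1 = c * c , λ {L} c*c≤L →
    subst P (decompose L c*c≤L) (P-+ (P-* (L % c) Pc+1) (P-* (L / c ∸ L % c) Pc))
    where
    -- The truncated subtraction q ∸ r is exact: r < c ≤ q because c² ≤ L.
    decompose : ∀ L → c * c ≤ L → L % c * suc c + (L / c ∸ L % c) * c ≡ L
    decompose L c*c≤L = begin
      r * suc c + (q ∸ r) * c    ≡⟨ cong (_+ (q ∸ r) * c) (*-suc r c) ⟩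
      r + r * c + (q ∸ r) * c    ≡⟨ +-assoc r (r * c) _ ⟩
      r + (r * c + (q ∸ r) * c)  ≡⟨ cong (r +_) (*-distribʳ-+ c r (q ∸ r)) ⟨
      r + (r + (q ∸ r)) * c      ≡⟨ cong (λ x → r + x * c) (m+[n∸m]≡n r≤q) ⟩
      r + q * c                  ≡⟨ m≡m%n+[m/n]*n L c ⟨
      L                          ∎
      where
      open ≡-Reasoning
      r q : ℕ
      r = L % c
      q = L / c
      r≤q : r ≤ q
      r≤q = <⇒≤ (<-≤-trans (m%n<n L c) (subst (_≤ q) (m*n/n≡m c c) (/-monoˡ-≤ c c*c≤L)))

  coprime⇒eventually : ∀ {a b} → Coprime a b → P a → P b → Eventually P
  coprime⇒eventually cop Pa Pb with coprime-Bézout cop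
  ... | Bézout.+- x y 1+yb≡xa =
    consecutive⇒eventually _ (P-* y Pb) (subst P (sym 1+yb≡xa) (P-* x Pa))
  ... | Bézout.-+ x y 1+xa≡yb =
    consecutive⇒eventually _ (P-* x Pa) (subst P (sym 1+xa≡yb) (P-* y Pb))

∈⇒≤sum : ∀ {n ns} → n ∈ ns → n ≤ sum ns
∈⇒≤sum {ns = m ∷ ns} (here refl) = m≤m+n m (sum ns)
∈⇒≤sum {ns = m ∷ ns} (there n∈ns) = ≤-trans (∈⇒≤sum n∈ns) (m≤n+m (sum ns) m)

mmul-pos : ∀ {N} {A B : Matrix N} {i j k} → 0 < A i j → 0 < B j k → 0 < mmul A B i k
mmul-pos {A = A} {B} {i} {j} {k} Aij>0 Bjk>0 =
  <-≤-trans (*-mono-< Aij>0 Bjk>0) (∈⇒≤sum (∈-map⁺ (λ l → A i l * B l k) (∈-allFin j)))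

≡⇒indicator-pos : ∀ {m n} → m ≡ n → 0 < (if m ≡ᵇ n then 1 else 0)
≡⇒indicator-pos {m} {n} m≡n rewrite Equivalence.to T-≡ (≡⇒≡ᵇ m n m≡n) = z<s

data Walk {N} (A : Matrix N) : ℕ → Fin N → Fin N → Set where
  []  : ∀ {i} → Walk A 0 i i
  _∷_ : ∀ {i j k m} → 0 < A i j → Walk A m j k → Walk A (suc m) i k

module _ {N} {A : Matrix N} where

  _++_ : ∀ {m m′ i j k} → Walk A m i j → Walk A m′ j k → Walk A (m + m′) i k
  []      ++ w′ = w′
  (e ∷ w) ++ w′ = e ∷ (w ++ w′)

  unsnoc : ∀ {m i k} → Walk A (suc m) i k → ∃[ j ] (Walk A m i j × 0 < A j k)
  unsnoc (e ∷ []) = _ , [] , e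
  unsnoc (e ∷ w@(_ ∷ _)) with unsnoc w
  ... | j , w′ , e′ = j , e ∷ w′ , e′

  walk⇒mpow-pos : ∀ {m i j} → Walk A m i j → 0 < mpow A m i j
  walk⇒mpow-pos {i = i} []  = ≡⇒indicator-pos {toℕ i} refl
  walk⇒mpow-pos {suc m} w with unsnoc w
  ... | _ , w′ , e = mmul-pos {A = mpow A m} {B = A} (walk⇒mpow-pos w′) e

  closed-walks-eventually⇒primitive : ∀ {v} D →
    (∀ i → ∃[ d ] (d ≤ D × Walk A d i v)) →
    (∀ j → ∃[ e ] (e ≤ D × Walk A e v j)) →
    Eventually (λ L → Walk A L v v) → Primitive A
  closed-walks-eventually⇒primitive D to from (K , closed) =
    suc K + D + D , s≤s z≤n , positive
    where
    positive : ∀ i j → 0 < mpow A (suc K + D + D) i j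
    positive i j with to i | from j
    ... | d , d≤D , i→v | e , e≤D , v→j =
      subst (λ m → 0 < mpow A m i j) length (walk⇒mpow-pos (i→v ++ (closed K≤L ++ v→j)))
      where
      open ≡-Reasoning
      open +-*-Solver
      L : ℕ
      L = suc K + (D ∸ d) + (D ∸ e)
      K≤L : K ≤ L
      K≤L = ≤-trans (n≤1+n K) (≤-trans (m≤m+n (suc K) (D ∸ d)) (m≤m+n _ (D ∸ e)))
      length : d + (L + e) ≡ suc K + D + D
      length = begin
        d + (L + e)
          ≡⟨ solve 5 (λ d k x y e → d :+ ((k :+ x :+ y) :+ e) := k :+ (d :+ x) :+ (y :+ e))
                     refl d (suc K) (D ∸ d) (D ∸ e) e ⟩
        suc K + (d + (D ∸ d)) + ((D ∸ e) + e)
          ≡⟨ cong₂ (λ x y → suc K + x + y) (m+[n∸m]≡n d≤D) (m∸n+n≡m e≤D) ⟩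
        suc K + D + D
          ∎

bAt-toℕ : ∀ {N} (b : Fin N → Bool) (k : Fin N) → bAt b (suc (toℕ k)) ≡ b k
bAt-toℕ {suc N} b zero    = refl
bAt-toℕ {suc N} b (suc k) = bAt-toℕ (b ∘ suc) k

bAt≡true⇒ : ∀ {N} (b : Fin N → Bool) {s} → bAt b s ≡ true →
            ∃[ k ] (b k ≡ true × suc (toℕ k) ≡ s)
bAt≡true⇒ {suc N} b {suc zero}    b₁ = zero , b₁ , refl
bAt≡true⇒ {suc N} b {suc (suc s)} bₛ with bAt≡true⇒ (b ∘ suc) bₛ
... | k , bk , k+1≡s = suc k , bk , cong suc k+1≡s

countOnes-suc : ∀ {n} (b : Fin (suc n) → Bool) →
                countOnes b ≡ boolToℕ (b zero) + countOnes (b ∘ suc)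
countOnes-suc b = cong (λ xs → boolToℕ (b zero) + sum xs)
  (trans (map-tabulate suc (boolToℕ ∘ b)) (sym (map-tabulate id (boolToℕ ∘ b ∘ suc))))

1<countOnes⇒nonlast-one : ∀ {n} (b : Fin (suc n) → Bool) → 1 < countOnes b →
                          ∃[ k ] (toℕ k < n × b k ≡ true)
1<countOnes⇒nonlast-one {zero}  b 1<ones with b zero | 1<ones
... | true  | s≤s ()
... | false | ()
1<countOnes⇒nonlast-one {suc n} b 1<ones with b zero in b₀ | subst (1 <_) (countOnes-suc b) 1<ones
... | true  | _          = zero , z<s , b₀
... | false | 1<ones-tail with 1<countOnes⇒nonlast-one (b ∘ suc) 1<ones-tail
...   | k , k<n , bk = suc k , s≤s k<n , bk

module _ {n} (b : Fin (suc n) → Bool) where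

  companion-subdiagonal : (i : Fin n) → 0 < companion b (suc i) (inject₁ i)
  companion-subdiagonal i = ≡⇒indicator-pos (toℕ-inject₁ i)

  companion-first-row : ∀ {k} → b k ≡ true → 0 < companion b zero k
  companion-first-row bk = subst (λ x → 0 < boolToℕ x) (sym bk) z<s

  descend : ∀ d {u w : Fin (suc n)} → toℕ u ≡ d + toℕ w → Walk (companion b) d u w
  descend zero    {u} u≡w = subst (Walk (companion b) 0 u) (toℕ-injective u≡w) []
  descend (suc d) {suc i} u≡w =
    companion-subdiagonal i ∷ descend d (trans (toℕ-inject₁ i) (suc-injective u≡w))

  walk-to-zero : ∀ i → Walk (companion b) (toℕ i) i zero
  walk-to-zero i = descend (toℕ i) (sym (+-identityʳ (toℕ i)))

  walk-from-zero : ∀ {k j} → b k ≡ true → toℕ j ≤ toℕ k →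
                   Walk (companion b) (suc (toℕ k ∸ toℕ j)) zero j
  walk-from-zero bk j≤k = companion-first-row bk ∷ descend _ (sym (m∸n+n≡m j≤k))

  closed-walk : ∀ {s} → bAt b s ≡ true → Walk (companion b) s zero zero
  closed-walk bₛ with bAt≡true⇒ b bₛ
  ... | k , bk , k+1≡s = subst (λ L → Walk (companion b) L zero zero) k+1≡s (walk-from-zero bk z≤n)

  companion-primitive : bAt b (suc n) ≡ true → ∀ {s₁ s₂} → Coprime s₁ s₂ →
    bAt b s₁ ≡ true → bAt b s₂ ≡ true → Primitive (companion b)
  companion-primitive bₙ cop b₁ b₂ =
    closed-walks-eventually⇒primitive (suc n) to from
      (coprime⇒eventually cop (closed-walk b₁) (closed-walk b₂))
    where
    open AdditivelyClosed (λ L → Walk (companion b) L zero zero) [] _++_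
    to : ∀ i → ∃[ d ] (d ≤ suc n × Walk (companion b) d i zero)
    to i = toℕ i , <⇒≤ (toℕ<n i) , walk-to-zero i
    from : ∀ j → ∃[ e ] (e ≤ suc n × Walk (companion b) e zero j)
    from j with bAt≡true⇒ b bₙ
    ... | k , bk , k+1≡n+1 =
      suc (toℕ k ∸ toℕ j) , s≤s (≤-trans (m∸n≤m (toℕ k) (toℕ j)) k≤n) ,
      walk-from-zero bk (subst (toℕ j ≤_) (sym k≡n) (toℕ≤pred[n] j))
      where
      k≡n : toℕ k ≡ n
      k≡n = suc-injective k+1≡n+1
      k≤n : toℕ k ≤ n
      k≤n = ≤-reflexive k≡n

  prime⇒companion-primitive : bAt b (suc n) ≡ true → 1 < countOnes b → Prime (suc n) →
                              Primitive (companion b)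
  prime⇒companion-primitive bₙ 1<ones N-prime with 1<countOnes⇒nonlast-one b 1<ones
  ... | k , k<n , bk = companion-primitive bₙ (Coprimality.sym (prime⇒coprime N-prime (s≤s k<n)))
                         (trans (bAt-toℕ b k) bk) bₙ

corollary4p2 :
    ((N : ℕ) (b : Fin N → Bool) → IsSilver N b →
      (bAt b 1 ≡ true
        ⊎ Prime N
        ⊎ Σ ℕ (λ s₁ → Σ ℕ (λ s₂ →
            Coprime s₁ s₂ × (1 < s₁) × (s₁ < N) × (1 < s₂) × (s₂ < N)
            × (bAt b s₁ ≡ true) × (bAt b s₂ ≡ true)))) →
      Primitive (companion b))
    × ((N : ℕ) → IsSilver N (λ _ → true) → Primitive (companion {N} (λ _ → true)))
corollary4p2 =
  (λ where
    zero    _ (() , _) _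
    (suc n) b (_ , bₙ , _) (inj₁ b₁) → companion-primitive b bₙ (1-coprimeTo (suc n)) b₁ bₙ
    (suc n) b (_ , bₙ , 1<ones) (inj₂ (inj₁ N-prime)) →
      prime⇒companion-primitive b bₙ 1<ones N-prime
    (suc n) b (_ , bₙ , _) (inj₂ (inj₂ (_ , _ , cop , _ , _ , _ , _ , b₁ , b₂))) →
      companion-primitive b bₙ cop b₁ b₂)
  , λ where
    zero    (() , _)
    (suc n) (_ , bₙ , _) → companion-primitive (λ _ → true) bₙ (1-coprimeTo (suc n)) refl bₙ
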